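{- Let $G=(V,E)$ be a finite simple graph of order $n$ and $T=n-1$. Let $(x,y,z)$ be an optimal solution of the model minimizing $\sum_{v\in V}x^0_v+\frac{1}{2T}\sum_{t\in[T]}z^t$ over binary variables $x^t_v$ ($v\in V$, $t\in\{0,\ldots,T\}$), $y^t_a$ ($a\in A$, $t\in[T]$), $z^t$ ($t\in[T]$) subject to (1) $x^0_v+\sum_{t\in[T]}\sum_{a=(u,v)\in A}y^t_a=1$ for all $v$; (2) $y^t_a\le x^{t-1}_u$ for all $a=(u,v)\in A$, $t\in[T]$; (3) $y^t_a\le x^{t-1}_w$ for all $a=(u,v)\in A$, $w\in N(u)\setminus\{v\}$, $t\in[T]$; (4) $x^t_v=x^{t-1}_v+\sum_{a=(u,v)\in A}y^t_a$ for all $v$, $t\in[T]$; (5) $x^{t-1}_u-x^{t-1}_v+\sum_{w\in N(u)\setminus\{v\}}x^{t-1}_w\le\sum_{a=(w,v)\in A}y^t_a+\deg(u)-1$ for all $(u,v)\in A$, $t\in[T]$; (6) $\frac1n\sum_{v}(x^t_v-x^{t-1}_v)-z^t\le0$ for all $t\in[T]$; (7) $z^t-\sum_{v}(x^t_v-x^{t-1}_v)\le0$ for all $t\in[T]$. Then $C=\{v\in V: x^0_v=1\}$ is a minimum zero forcing set of $G$ such that $\operatorname{pt}(G)=\operatorname{pt}(G,C)=\sum_{t\in[T]}z^t$.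
   Context: $[T]=\{1,\ldots,T\}$; $N(u)$ is the neighborhood, $\deg(u)=|N(u)|$; $A$ contains both arcs $(u,v),(v,u)$ for each edge. Standard zero forcing rule: a filled vertex $u$ forces a non-filled vertex $v$ if $v$ is the only non-filled neighbor of $u$. A zero forcing set is a set from which repeated forcing fills all vertices; a minimum one has cardinality $Z(G)$. $\operatorname{pt}(G,C)$ is the number of time steps needed to fill all vertices from $C$ when at each step all possible forces are applied simultaneously; $\operatorname{pt}(G)=\min\{\operatorname{pt}(G,C): C\text{ zero forcing set}, |C|=Z(G)\}$. -}

module Defs where

open import Data.Bool using (Bool; true; false; _∧_; _∨_; not; if_then_else_)
open import Data.Nat as ℕ using (ℕ; zero; suc)
open import Data.Fin using (Fin; zero; suc; inject₁; _≟_)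
open import Data.Integer as ℤ using (ℤ; +_)
open import Data.Rational as ℚ using (ℚ)
open import Data.Product using (Σ; ∃; _×_; _,_)
open import Relation.Nullary.Decidable using (⌊_⌋)
open import Relation.Binary.PropositionalEquality using (_≡_)

record Graph (n : ℕ) : Set where
  field
    adj     : Fin n → Fin n → Bool
    symm    : ∀ u v → adj u v ≡ adj v u
    irrefl  : ∀ u → adj u u ≡ false
open Graph public

sumℤ : ∀ {n} → (Fin n → ℤ) → ℤ
sumℤ {zero}  f = + 0
sumℤ {suc n} f = f zero ℤ.+ sumℤ (λ i → f (suc i))

sumℕ : ∀ {n} → (Fin n → ℕ) → ℕ
sumℕ {zero}  f = 0
sumℕ {suc n} f = f zero ℕ.+ sumℕ (λ i → f (suc i))

anyF : ∀ {n} → (Fin n → Bool) → Bool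
anyF {zero}  f = false
anyF {suc n} f = f zero ∨ anyF (λ i → f (suc i))

allF : ∀ {n} → (Fin n → Bool) → Bool
allF {zero}  f = true
allF {suc n} f = f zero ∧ allF (λ i → f (suc i))

b2ℕ : Bool → ℕ
b2ℕ true  = 1
b2ℕ false = 0

b2ℤ : Bool → ℤ
b2ℤ b = + b2ℕ b

_==_ : ∀ {n} → Fin n → Fin n → Bool
i == j = ⌊ i ≟ j ⌋

deg : ∀ {n} → Graph n → Fin n → ℕ
deg G u = sumℕ (λ w → b2ℕ (adj G u w))

VSet : ℕ → Set
VSet n = Fin n → Bool

card : ∀ {n} → VSet n → ℕ
card S = sumℕ (λ v → b2ℕ (S v))

-- one time step with all possible forces applied simultaneously:
-- v becomes filled if some filled neighbour u of v has all its
-- neighbours other than v filled (so v is its unique non-filled neighbour)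
step : ∀ {n} → Graph n → VSet n → VSet n
step G S v = S v ∨ anyF (λ u → S u ∧ adj G u v ∧
                allF (λ w → not (adj G u w) ∨ (w == v) ∨ S w))

fill : ∀ {n} → Graph n → VSet n → ℕ → VSet n
fill G S zero    = S
fill G S (suc k) = step G (fill G S k)

AllFilled : ∀ {n} → VSet n → Set
AllFilled S = ∀ v → S v ≡ true

IsZeroForcingSet : ∀ {n} → Graph n → VSet n → Set
IsZeroForcingSet G S = ∃ λ k → AllFilled (fill G S k)

IsMinZeroForcingSet : ∀ {n} → Graph n → VSet n → Set
IsMinZeroForcingSet G C =
  IsZeroForcingSet G C × (∀ C' → IsZeroForcingSet G C' → card C ℕ.≤ card C')

IsPropTime : ∀ {n} → Graph n → VSet n → ℕ → Set
IsPropTime G C k =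
  AllFilled (fill G C k) × (∀ j → AllFilled (fill G C j) → k ℕ.≤ j)

IsGraphPropTime : ∀ {n} → Graph n → ℕ → Set
IsGraphPropTime G k =
  (∃ λ C → IsMinZeroForcingSet G C × IsPropTime G C k) ×
  (∀ C j → IsMinZeroForcingSet G C → IsPropTime G C j → k ℕ.≤ j)

-- Time t ∈ {0..T} is Fin (suc T); t ∈ [T] = {1..T} is encoded by
-- i : Fin T with t = suc i, so x^{t-1} = x (inject₁ i), x^t = x (suc i).
-- y is given on all ordered pairs (u,v); only pairs with adj u v (the
-- arcs of A) ever occur in the model.

record Sol (T : ℕ) : Set where
  field
    x : Fin (suc T) → Fin (suc T) → Bool          -- x t v
    y : Fin T → Fin (suc T) → Fin (suc T) → Bool  -- y t u v  (arc (u,v))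
    z : Fin T → Bool
open Sol public

module _ {T : ℕ} (G : Graph (suc T)) (s : Sol T) where
  private
    n = suc T
    A = adj G
    X : Fin (suc T) → Fin n → ℤ
    X t v = b2ℤ (x s t v)
    Y : Fin T → Fin n → Fin n → ℤ
    Y t u v = b2ℤ (y s t u v)
    inY : Fin T → Fin n → ℤ
    inY t v = sumℤ (λ u → if A u v then Y t u v else + 0)
    nbSum : Fin n → Fin n → (Fin n → ℤ) → ℤ
    nbSum u v f = sumℤ (λ w → if A u w ∧ not (w == v) then f w else + 0)
    diff : Fin T → ℤ
    diff t = sumℤ (λ v → X (suc t) v ℤ.- X (inject₁ t) v)

  Feasible : Set
  Feasible =
    (∀ v → X zero v ℤ.+ sumℤ (λ t → inY t v) ≡ + 1) ×
    (∀ t u v → A u v ≡ true → Y t u v ℤ.≤ X (inject₁ t) u) ×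
    (∀ t u v w → A u v ≡ true → A u w ≡ true → (w == v) ≡ false →
       Y t u v ℤ.≤ X (inject₁ t) w) ×
    (∀ t v → X (suc t) v ≡ X (inject₁ t) v ℤ.+ inY t v) ×
    (∀ t u v → A u v ≡ true →
       X (inject₁ t) u ℤ.- X (inject₁ t) v ℤ.+ nbSum u v (X (inject₁ t))
         ℤ.≤ inY t v ℤ.+ (+ deg G u) ℤ.- + 1) ×
    (∀ t → (diff t ℚ./ n) ℚ.- (b2ℤ (z s t) ℚ./ 1) ℚ.≤ ℚ.0ℚ) ×
    (∀ t → b2ℤ (z s t) ℤ.- diff t ℤ.≤ + 0)

-- objective  Σ_v x^0_v + (1/(2T)) Σ_{t∈[T]} z^t   (for T = 0 the second
-- sum is empty and the objective is Σ_v x^0_v)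
objective : ∀ {T} → Sol T → ℚ
objective {zero}  s = (+ sumℕ (λ v → b2ℕ (x s zero v))) ℚ./ 1
objective {suc k} s =
  ((+ sumℕ (λ v → b2ℕ (x s zero v))) ℚ./ 1) ℚ.+
  ((+ sumℕ (λ t → b2ℕ (z s t))) ℚ./ (2 ℕ.* suc k))

IsOptimal : ∀ {T} → Graph (suc T) → Sol T → Set
IsOptimal G s = Feasible G s × (∀ s' → Feasible G s' → objective s ℚ.≤ objective s')

initialSet : ∀ {T} → Sol T → VSet (suc T)
initialSet s v = x s zero v

zSum : ∀ {T} → Sol T → ℕ
zSum s = sumℕ (λ t → b2ℕ (z s t))

{-# OPTIONS --safe #-}
module Submission where

-- The model describes a run of the synchronous zero forcing process: x^t is the set filled
-- after t steps, y^t picks one forcing arc into each vertex filled at step t, and z^t records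
-- whether step t fills anything. Constraints (2)-(5) force x^t to be exactly the t-th iterate
-- of the forcing step from C = x^0, (1) makes every vertex filled by time T, and (6)-(7) make
-- z^t = 1 exactly while the process is still running, so Σ z^t = pt(G, C). Conversely, every
-- zero forcing set D yields a feasible solution with x^0 = D and Σ z^t = pt(G, D). As
-- Σ z^t ≤ T < 2T, the objective orders solutions lexicographically by (|x^0|, Σ z^t), so an
-- optimal C is a minimum zero forcing set whose propagation time is least among them.

open import Data.Bool using (Bool; true; false; _∧_; _∨_; not; if_then_else_)
import Data.Bool as Bool
open import Data.Bool.Properties using (∧-conicalˡ; ∧-conicalʳ; ∨-zeroʳ; not-injective; if-float; T-≡)
open import Data.Empty using (⊥-elim)
open import Data.Fin using (Fin; zero; suc; toℕ; inject₁; _≟_)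
import Data.Fin.Properties as Finₚ
open import Data.Integer as ℤ using (ℤ; +_)
import Data.Integer.Properties as ℤₚ
open import Data.Integer.Solver using (module +-*-Solver)
open import Data.Nat using (ℕ; zero; suc; pred; _+_; _*_; _≤_; _<_; _≤′_; ≤′-refl; ≤′-step; z≤n; s≤s)
import Data.Nat.Properties as ℕₚ
open import Data.Product using (∃; _×_; _,_; proj₁; proj₂)
import Data.Rational as ℚ
import Data.Rational.Properties as ℚₚ
open import Data.Rational.Unnormalised as ℚᵘ using (mkℚᵘ)
import Data.Rational.Unnormalised.Properties as ℚᵘₚ
open import Data.Sum using (inj₁; inj₂)
open import Function.Base using (_∘_; case_of_)
open import Function.Bundles using (_⇔_; mk⇔; Equivalence)
open import Function.Construct.Composition using (_⇔-∘_)
open import Relation.Binary.PropositionalEquality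
open import Relation.Nullary using (¬_; yes; no)
open import Relation.Nullary.Decidable using (toWitness)

open import Defs

open Equivalence using (to; from)
open import Algebra.Properties.CommutativeSemigroup ℕₚ.+-commutativeSemigroup
  using () renaming (interchange to +-interchange)
open +-*-Solver using (_:+_; _:-_; _:=_; con) renaming (solve to ℤ-solve)


b2ℕ-injective : ∀ {a b} → b2ℕ a ≡ b2ℕ b → a ≡ b
b2ℕ-injective {false} {false} _ = refl
b2ℕ-injective {true}  {true}  _ = refl

b2ℕ-≢0 : ∀ {b} → b2ℕ b ≢ 0 → b ≡ true
b2ℕ-≢0 {false} ≢0 = ⊥-elim (≢0 refl)
b2ℕ-≢0 {true}  _  = refl

b2ℕ≤1 : ∀ b → b2ℕ b ≤ 1
b2ℕ≤1 false = z≤n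
b2ℕ≤1 true  = s≤s z≤n

b2ℕ-≤⇔ : ∀ {a b} → b2ℕ a ≤ b2ℕ b ⇔ (a ≡ true → b ≡ true)
b2ℕ-≤⇔ {false}         = mk⇔ (λ _ ()) (λ _ → z≤n)
b2ℕ-≤⇔ {true}  {false} = mk⇔ (λ ()) (λ a⇒b → case a⇒b refl of λ ())
b2ℕ-≤⇔ {true}  {true}  = mk⇔ (λ _ _ → refl) (λ _ → s≤s z≤n)

b2ℕ-∨ : ∀ a b → b2ℕ (a ∨ b) ≡ b2ℕ a + b2ℕ (not a ∧ b)
b2ℕ-∨ false b = refl
b2ℕ-∨ true  b = refl

==⇒≡ : ∀ {n} {i j : Fin n} → (i == j) ≡ true → i ≡ j
==⇒≡ h = toWitness (from T-≡ h)

==-suc : ∀ {n} (i j : Fin n) → (suc i == suc j) ≡ (i == j)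
==-suc i j with i ≟ j
... | yes _ = refl
... | no  _ = refl

anyF⁺ : ∀ {n} (f : Fin n → Bool) i → f i ≡ true → anyF f ≡ true
anyF⁺ f zero    fi rewrite fi = refl
anyF⁺ f (suc i) fi rewrite anyF⁺ (f ∘ suc) i fi = ∨-zeroʳ (f zero)

anyF⁻ : ∀ {n} (f : Fin n → Bool) → anyF f ≡ true → ∃ λ i → f i ≡ true
anyF⁻ {suc n} f h with f zero in f0
... | true  = zero , f0
... | false = let i , fi = anyF⁻ (f ∘ suc) h in suc i , fi

allF⁺ : ∀ {n} (f : Fin n → Bool) → (∀ i → f i ≡ true) → allF f ≡ true
allF⁺ {zero}  f h = refl
allF⁺ {suc n} f h rewrite h zero = allF⁺ (f ∘ suc) (h ∘ suc)

allF⁻ : ∀ {n} (f : Fin n → Bool) → allF f ≡ true → ∀ i → f i ≡ true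
allF⁻ f h zero    = ∧-conicalˡ _ _ h
allF⁻ f h (suc i) = allF⁻ (f ∘ suc) (∧-conicalʳ _ _ h) i

allF⇔ : ∀ {n} (S : VSet n) → AllFilled S ⇔ allF S ≡ true
allF⇔ S = mk⇔ (allF⁺ S) (allF⁻ S)

anyF-cong : ∀ {n} {f g : Fin n → Bool} → f ≗ g → anyF f ≡ anyF g
anyF-cong {zero}  eq = refl
anyF-cong {suc n} eq = cong₂ _∨_ (eq zero) (anyF-cong (eq ∘ suc))

allF-cong : ∀ {n} {f g : Fin n → Bool} → f ≗ g → allF f ≡ allF g
allF-cong {zero}  eq = refl
allF-cong {suc n} eq = cong₂ _∧_ (eq zero) (allF-cong (eq ∘ suc))

sumℕ-cong : ∀ {n} {f g : Fin n → ℕ} → f ≗ g → sumℕ f ≡ sumℕ g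
sumℕ-cong {zero}  eq = refl
sumℕ-cong {suc n} eq = cong₂ _+_ (eq zero) (sumℕ-cong (eq ∘ suc))

sumℤ-cong : ∀ {n} {f g : Fin n → ℤ} → f ≗ g → sumℤ f ≡ sumℤ g
sumℤ-cong {zero}  eq = refl
sumℤ-cong {suc n} eq = cong₂ ℤ._+_ (eq zero) (sumℤ-cong (eq ∘ suc))

sumℕ-distrib-+ : ∀ {n} (f g : Fin n → ℕ) → sumℕ (λ i → f i + g i) ≡ sumℕ f + sumℕ g
sumℕ-distrib-+ {zero}  f g = refl
sumℕ-distrib-+ {suc n} f g rewrite sumℕ-distrib-+ (f ∘ suc) (g ∘ suc) =
  +-interchange (f zero) (g zero) (sumℕ (f ∘ suc)) (sumℕ (g ∘ suc))

sumℕ-mono : ∀ {n} {f g : Fin n → ℕ} → (∀ i → f i ≤ g i) → sumℕ f ≤ sumℕ g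
sumℕ-mono {zero}  f≤g = z≤n
sumℕ-mono {suc n} f≤g = ℕₚ.+-mono-≤ (f≤g zero) (sumℕ-mono (f≤g ∘ suc))

≤-sumℕ : ∀ {n} (f : Fin n → ℕ) i → f i ≤ sumℕ f
≤-sumℕ f zero    = ℕₚ.m≤m+n (f zero) _
≤-sumℕ f (suc i) = ℕₚ.≤-trans (≤-sumℕ (f ∘ suc) i) (ℕₚ.m≤n+m _ (f zero))

sumℕ≡0⇔ : ∀ {n} (f : Fin n → ℕ) → sumℕ f ≡ 0 ⇔ (∀ i → f i ≡ 0)
sumℕ≡0⇔ f =
  mk⇔ (λ sum≡0 i → ℕₚ.n≤0⇒n≡0 (subst (f i ≤_) sum≡0 (≤-sumℕ f i))) (all-zero f)
  where
  all-zero : ∀ {n} (f : Fin n → ℕ) → (∀ i → f i ≡ 0) → sumℕ f ≡ 0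
  all-zero {zero}  f h = refl
  all-zero {suc n} f h rewrite h zero = all-zero (f ∘ suc) (h ∘ suc)

sumℕ-witness : ∀ {n} (f : Fin n → ℕ) → sumℕ f ≢ 0 → ∃ λ i → f i ≢ 0
sumℕ-witness {zero}  f ≢0 = ⊥-elim (≢0 refl)
sumℕ-witness {suc n} f ≢0 with f zero in f0
... | zero  = let i , fi≢0 = sumℕ-witness (f ∘ suc) ≢0 in suc i , fi≢0
... | suc _ = zero , λ f0≡0 → ℕₚ.0≢1+n (trans (sym f0≡0) f0)

sumℕ-indicator : ∀ {n} (v : Fin n) → sumℕ (λ w → b2ℕ (w == v)) ≡ 1
sumℕ-indicator {suc n} zero    = cong suc (from (sumℕ≡0⇔ {n} _) λ _ → refl)
sumℕ-indicator {suc n} (suc v) = trans (sumℕ-cong λ w → cong b2ℕ (==-suc w v)) (sumℕ-indicator v)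

sumℤ-+ : ∀ {n} (f : Fin n → ℕ) → sumℤ (λ i → + f i) ≡ + sumℕ f
sumℤ-+ {zero}  f = refl
sumℤ-+ {suc n} f = cong (λ r → + f zero ℤ.+ r) (sumℤ-+ (f ∘ suc))

sumℤ-if : ∀ {n} (c : Fin n → Bool) (f : Fin n → ℕ) →
          sumℤ (λ i → if c i then + f i else + 0) ≡ + sumℕ (λ i → if c i then f i else 0)
sumℤ-if {n} c f = trans (sumℤ-cong λ i → sym (if-float +_ (c i))) (sumℤ-+ {n} _)

sumℤ-differences : ∀ {n} (a b c : Fin n → ℕ) → (∀ i → a i ≡ b i + c i) →
                   sumℤ (λ i → + a i ℤ.- + b i) ≡ + sumℕ c
sumℤ-differences a b c a≡b+c = trans (sumℤ-cong difference) (sumℤ-+ c)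
  where
  difference : ∀ i → + a i ℤ.- + b i ≡ + c i
  difference i rewrite a≡b+c i = ℤ-solve 2 (λ x y → (x :+ y) :- x := y) refl (+ b i) (+ c i)

telescope : (h d : ℕ → ℕ) → (∀ j → h (suc j) ≡ h j + d j) →
            ∀ m → h 0 + sumℕ {m} (λ t → d (toℕ t)) ≡ h m
telescope h d step zero    = ℕₚ.+-identityʳ (h 0)
telescope h d step (suc m) = begin
  h 0 + (d 0 + sumℕ {m} (λ t → d (suc (toℕ t))))  ≡⟨ sym (ℕₚ.+-assoc (h 0) (d 0) _) ⟩
  (h 0 + d 0) + sumℕ {m} (λ t → d (suc (toℕ t)))  ≡⟨ cong (_+ _) (sym (step 0)) ⟩
  h 1 + sumℕ {m} (λ t → d (suc (toℕ t)))          ≡⟨ telescope (h ∘ suc) (d ∘ suc) (step ∘ suc) m ⟩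
  h (suc m)                                       ∎
  where open ≡-Reasoning

_⊆_ : ∀ {n} → VSet n → VSet n → Set
S ⊆ S′ = ∀ v → S v ≡ true → S′ v ≡ true

card-≤ : ∀ {n} (S : VSet n) → card S ≤ n
card-≤ {zero}  S = z≤n
card-≤ {suc n} S = ℕₚ.+-mono-≤ (b2ℕ≤1 (S zero)) (card-≤ (S ∘ suc))

card-full : ∀ {n} → card {n} (λ _ → true) ≡ n
card-full {zero}  = refl
card-full {suc n} = cong suc (card-full {n})

card≡0⇔ : ∀ {n} (S : VSet n) → card S ≡ 0 ⇔ (∀ v → S v ≡ false)
card≡0⇔ S = mk⇔ (λ c≡0 v → b2ℕ-injective (to (sumℕ≡0⇔ _) c≡0 v))
                (λ empty → from (sumℕ≡0⇔ _) (λ v → cong b2ℕ (empty v)))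

card-witness : ∀ {n} (S : VSet n) → card S ≢ 0 → ∃ λ v → S v ≡ true
card-witness S c≢0 = let v , Sv≢0 = sumℕ-witness _ c≢0 in v , b2ℕ-≢0 Sv≢0

card-pos : ∀ {n} (S : VSet n) {u} → S u ≡ true → 0 < card S
card-pos S {u} Su = subst (λ b → b2ℕ b ≤ card S) Su (≤-sumℕ (λ w → b2ℕ (S w)) u)

card-< : ∀ {n} {S S′ : VSet n} {v} → S ⊆ S′ → S v ≡ false → S′ v ≡ true → card S < card S′
card-< {S = S} {S′} {v} S⊆S′ Sv S′v = begin
  suc (card S)                            ≡⟨ ℕₚ.+-comm 1 (card S) ⟩
  card S + 1                              ≡⟨ cong (_+_ (card S)) (sym (sumℕ-indicator v)) ⟩
  card S + sumℕ (λ w → b2ℕ (w == v))      ≡⟨ sym (sumℕ-distrib-+ (λ w → b2ℕ (S w)) _) ⟩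
  sumℕ (λ w → b2ℕ (S w) + b2ℕ (w == v))   ≤⟨ sumℕ-mono pointwise ⟩
  card S′                                 ∎
  where
  open ℕₚ.≤-Reasoning
  pointwise : ∀ w → b2ℕ (S w) + b2ℕ (w == v) ≤ b2ℕ (S′ w)
  pointwise w with w == v in w==v
  ... | true  rewrite ==⇒≡ w==v | Sv | S′v = ℕₚ.≤-refl
  ... | false = subst (_≤ _) (sym (ℕₚ.+-identityʳ _)) (from b2ℕ-≤⇔ (S⊆S′ w))

card≥n⇒AllFilled : ∀ {n} (S : VSet n) → n ≤ card S → AllFilled S
card≥n⇒AllFilled {n} S n≤card v with S v in Sv
... | true  = refl
... | false = ⊥-elim (ℕₚ.<⇒≱ (subst (card S <_) (card-full {n}) card<n) n≤card)
  where
  card<n : card S < card {n} (λ _ → true)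
  card<n = card-< {S = S} (λ _ _ → refl) Sv refl

sumℕ-if-redundant : ∀ {n} (c f : Fin n → Bool) → (∀ i → f i ≡ true → c i ≡ true) →
                    sumℕ (λ i → if c i then b2ℕ (f i) else 0) ≡ card f
sumℕ-if-redundant c f f⇒c = sumℕ-cong pointwise
  where
  pointwise : ∀ i → (if c i then b2ℕ (f i) else 0) ≡ b2ℕ (f i)
  pointwise i with c i in ci | f i in fi
  ... | true  | _     = refl
  ... | false | false = refl
  ... | false | true  = case trans (sym (f⇒c i fi)) ci of λ ()

first : ∀ {n} → (Fin n → Bool) → Fin n → Bool
first f zero    = f zero
first f (suc i) = not (f zero) ∧ first (f ∘ suc) i

first⇒ : ∀ {n} (f : Fin n → Bool) i → first f i ≡ true → f i ≡ true
first⇒ f zero    h = h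
first⇒ f (suc i) h = first⇒ (f ∘ suc) i (∧-conicalʳ _ _ h)

card-first : ∀ {n} (f : Fin n → Bool) → card (first f) ≡ b2ℕ (anyF f)
card-first {zero}  f = refl
card-first {suc n} f with f zero
... | true  = cong suc (from (sumℕ≡0⇔ {n} _) λ _ → refl)
... | false = card-first (f ∘ suc)

-- Arithmetic of the model's constraints

≤1⇒≡b2ℕ : ∀ {i b} → i ≤ 1 → (i ≢ 0 ⇔ b ≡ true) → i ≡ b2ℕ b
≤1⇒≡b2ℕ {zero}        {false} _         _   = refl
≤1⇒≡b2ℕ {zero}        {true}  _         i⇔b = ⊥-elim (from i⇔b refl refl)
≤1⇒≡b2ℕ {suc zero}    {false} _         i⇔b = case to i⇔b (λ ()) of λ ()
≤1⇒≡b2ℕ {suc zero}    {true}  _         _   = refl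
≤1⇒≡b2ℕ {suc (suc _)} {_}     (s≤s ())  _

bit-bounds⇔ : ∀ {z a : Bool} {c n : ℕ} → c ≤ n → (c ≡ 0 ⇔ a ≡ true) →
              (b2ℕ z ≤ c × c ≤ b2ℕ z * n) ⇔ z ≡ not a
bit-bounds⇔ {false} {false} c≤n c≡0⇔a =
  mk⇔ (λ (_ , c≤0) → case to c≡0⇔a (ℕₚ.n≤0⇒n≡0 c≤0) of λ ()) (λ ())
bit-bounds⇔ {false} {true}  c≤n c≡0⇔a =
  mk⇔ (λ _ → refl) (λ _ → z≤n , ℕₚ.≤-reflexive (from c≡0⇔a refl))
bit-bounds⇔ {true}  {false} c≤n c≡0⇔a =
  mk⇔ (λ _ → refl) (λ _ → ℕₚ.n≢0⇒n>0 (λ c≡0 → case to c≡0⇔a c≡0 of λ ()) ,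
                          subst (_ ≤_) (sym (ℕₚ.+-identityʳ _)) c≤n)
bit-bounds⇔ {true}  {true}  c≤n c≡0⇔a =
  mk⇔ (λ (1≤c , _) → case subst (1 ≤_) (from c≡0⇔a refl) 1≤c of λ ()) (λ ())

-- The contribution of w to deg u, split into w = v, a filled neighbour w ≠ v of u, and an
-- unfilled one.
neighbour-split : ∀ a e s → (e ≡ true → a ≡ true) →
                  b2ℕ a ≡ (if a ∧ not e then b2ℕ s else 0) + b2ℕ (not (not a ∨ e ∨ s)) + b2ℕ e
neighbour-split false false s     _   = refl
neighbour-split false true  s     e⇒a = case e⇒a refl of λ ()
neighbour-split true  false false _   = refl
neighbour-split true  false true  _   = refl
neighbour-split true  true  s     _   = refl

[+m]-[+n]≤0⇔ : ∀ m n → + m ℤ.- + n ℤ.≤ + 0 ⇔ m ≤ n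
[+m]-[+n]≤0⇔ m n = mk⇔ (ℤₚ.drop‿+≤+ ∘ ℤₚ.i-j≤0⇒i≤j) (ℤₚ.i≤j⇒i-j≤0 ∘ ℤ.+≤+)

[a-b+e]≤[i+suc[e+k]-1]⇔ : ∀ a b e i k →
                          (+ a ℤ.- + b ℤ.+ + e ℤ.≤ + i ℤ.+ + suc (e + k) ℤ.- + 1) ⇔ a ≤ b + i + k
[a-b+e]≤[i+suc[e+k]-1]⇔ a b e i k = mk⇔
  (λ h → to ([+m]-[+n]≤0⇔ a (b + i + k)) (subst (λ d → d ℤ.≤ + 0) difference (ℤₚ.i≤j⇒i-j≤0 h)))
  (λ h → ℤₚ.i-j≤0⇒i≤j
           (subst (λ d → d ℤ.≤ + 0) (sym difference) (from ([+m]-[+n]≤0⇔ a (b + i + k)) h)))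
  where
  difference : (+ a ℤ.- + b ℤ.+ + e) ℤ.- (+ i ℤ.+ + suc (e + k) ℤ.- + 1) ≡ + a ℤ.- + (b + i + k)
  difference = ℤ-solve 5 (λ a b e i k → (a :- b :+ e) :- (i :+ (con (+ 1) :+ (e :+ k)) :- con (+ 1))
                                       := a :- (b :+ i :+ k))
                         refl (+ a) (+ b) (+ e) (+ i) (+ k)

p-q≤0⇔p≤q : ∀ p q → p ℚ.- q ℚ.≤ ℚ.0ℚ ⇔ p ℚ.≤ q
p-q≤0⇔p≤q p q = mk⇔
  (λ h → ℚₚ.toℚᵘ-cancel-≤ (ℚᵘₚ.p-q≤0⇒p≤q (ℚᵘₚ.≤-respˡ-≃ toℚᵘ-minus (ℚₚ.toℚᵘ-mono-≤ h))))
  (λ h → ℚₚ.toℚᵘ-cancel-≤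
           (ℚᵘₚ.≤-respˡ-≃ (ℚᵘₚ.≃-sym toℚᵘ-minus) (ℚᵘₚ.p≤q⇒p-q≤0 (ℚₚ.toℚᵘ-mono-≤ h))))
  where
  toℚᵘ-minus : ℚ.toℚᵘ (p ℚ.- q) ℚᵘ.≃ ℚ.toℚᵘ p ℚᵘ.- ℚ.toℚᵘ q
  toℚᵘ-minus =
    ℚᵘₚ.≃-trans (ℚₚ.toℚᵘ-homo-+ p (ℚ.- q)) (ℚᵘₚ.+-congʳ (ℚ.toℚᵘ p) (ℚₚ.toℚᵘ-homo‿- q))

toℚᵘ-/ : ∀ i d → ℚ.toℚᵘ (i ℚ./ suc d) ℚᵘ.≃ mkℚᵘ i d
toℚᵘ-/ i d = ℚₚ.toℚᵘ-fromℚᵘ (mkℚᵘ i d)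

/-≤-/⇔ : ∀ i d j e → (i ℚ./ suc d) ℚ.≤ (j ℚ./ suc e) ⇔ i ℤ.* + suc e ℤ.≤ j ℤ.* + suc d
/-≤-/⇔ i d j e = mk⇔
  (λ h → ℚᵘₚ.drop-*≤*
           (ℚᵘₚ.≤-respʳ-≃ (toℚᵘ-/ j e) (ℚᵘₚ.≤-respˡ-≃ (toℚᵘ-/ i d) (ℚₚ.toℚᵘ-mono-≤ h))))
  (λ h → ℚₚ.toℚᵘ-cancel-≤ (ℚᵘₚ.≤-respʳ-≃ (ℚᵘₚ.≃-sym (toℚᵘ-/ j e))
                            (ℚᵘₚ.≤-respˡ-≃ (ℚᵘₚ.≃-sym (toℚᵘ-/ i d)) (ℚᵘ.*≤* h))))

fraction-bound⇔ : ∀ c z m {i} → i ≡ + c →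
                  (i ℚ./ suc m) ℚ.- (+ z ℚ./ 1) ℚ.≤ ℚ.0ℚ ⇔ c ≤ z * suc m
fraction-bound⇔ c z m refl = mk⇔
  (λ h → ℤₚ.drop‿+≤+ (subst₂ ℤ._≤_ (ℤₚ.*-identityʳ (+ c)) (sym (ℤₚ.pos-* z (suc m)))
           (to (/-≤-/⇔ (+ c) m (+ z) 0) (to (p-q≤0⇔p≤q _ _) h))))
  (λ h → from (p-q≤0⇔p≤q _ _) (from (/-≤-/⇔ (+ c) m (+ z) 0)
           (subst₂ ℤ._≤_ (sym (ℤₚ.*-identityʳ (+ c))) (ℤₚ.pos-* z (suc m)) (ℤ.+≤+ h))))

mixed-≤⇒ : ∀ a p a′ p′ d →
           (+ a ℚ./ 1) ℚ.+ (+ p ℚ./ suc d) ℚ.≤ (+ a′ ℚ./ 1) ℚ.+ (+ p′ ℚ./ suc d) →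
           a * suc d + p ≤ a′ * suc d + p′
mixed-≤⇒ a p a′ p′ d h = ℤₚ.drop‿+≤+ (subst₂ ℤ._≤_ (numerator a p) (numerator a′ p′)
  (ℤₚ.*-cancelʳ-≤-pos _ _ _ (ℚᵘₚ.drop-*≤* (ℚᵘₚ.≤-respʳ-≃ (toℚᵘ-mixed a′ p′)
                                            (ℚᵘₚ.≤-respˡ-≃ (toℚᵘ-mixed a p) (ℚₚ.toℚᵘ-mono-≤ h))))))
  where
  toℚᵘ-mixed : ∀ a p → ℚ.toℚᵘ ((+ a ℚ./ 1) ℚ.+ (+ p ℚ./ suc d)) ℚᵘ.≃ mkℚᵘ (+ a) 0 ℚᵘ.+ mkℚᵘ (+ p) d
  toℚᵘ-mixed a p = ℚᵘₚ.≃-trans (ℚₚ.toℚᵘ-homo-+ (+ a ℚ./ 1) (+ p ℚ./ suc d))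
                               (ℚᵘₚ.+-cong (toℚᵘ-/ (+ a) 0) (toℚᵘ-/ (+ p) d))
  numerator : ∀ a p → + a ℤ.* + suc d ℤ.+ + p ℤ.* + 1 ≡ + (a * suc d + p)
  numerator a p = cong₂ ℤ._+_ (sym (ℤₚ.pos-* a (suc d))) (ℤₚ.*-identityʳ (+ p))

lex-≤ : ∀ {a p a′ p′ K} → p′ < K → a * K + p ≤ a′ * K + p′ → a ≤ a′ × (a ≡ a′ → p ≤ p′)
lex-≤ {a} {p} {a′} {p′} {K} p′<K h = a≤a′ , λ { refl → ℕₚ.+-cancelˡ-≤ (a * K) p p′ h }
  where
  open ℕₚ.≤-Reasoning
  a≤a′ : a ≤ a′
  a≤a′ = ℕₚ.≮⇒≥ λ a′<a → ℕₚ.<-irrefl refl (begin-strict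
    a′ * K + K    ≡⟨ ℕₚ.+-comm (a′ * K) K ⟩
    suc a′ * K    ≤⟨ ℕₚ.*-monoˡ-≤ K a′<a ⟩
    a * K         ≤⟨ ℕₚ.m≤m+n (a * K) p ⟩
    a * K + p     ≤⟨ h ⟩
    a′ * K + p′   <⟨ ℕₚ.+-monoʳ-< (a′ * K) p′<K ⟩
    a′ * K + K    ∎)

-- Zero forcing

module ZeroForcing {n : ℕ} (G : Graph n) where

  clear : VSet n → Fin n → Fin n → Fin n → Bool
  clear S u v w = not (adj G u w) ∨ (w == v) ∨ S w

  forces : VSet n → Fin n → Fin n → Bool
  forces S u v = S u ∧ adj G u v ∧ allF (clear S u v)

  newlyForced : VSet n → VSet n
  newlyForced S v = not (S v) ∧ anyF (λ u → forces S u v)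

  newCount : VSet n → ℕ
  newCount S = card (newlyForced S)

  blockers : VSet n → Fin n → Fin n → ℕ
  blockers S u v = card (not ∘ clear S u v)

  clear⇔ : ∀ S u v w → clear S u v w ≡ true ⇔ (adj G u w ≡ true → (w == v) ≡ false → S w ≡ true)
  clear⇔ S u v w with adj G u w | w == v
  ... | false | _     = mk⇔ (λ _ ()) (λ _ → refl)
  ... | true  | true  = mk⇔ (λ _ _ ()) (λ _ → refl)
  ... | true  | false = mk⇔ (λ Sw _ _ → Sw) (λ h → h refl refl)

  allF-clear⇔ : ∀ S u v →
                allF (clear S u v) ≡ true ⇔ (∀ w → adj G u w ≡ true → (w == v) ≡ false → S w ≡ true)
  allF-clear⇔ S u v = mk⇔ (λ h w → to (clear⇔ S u v w) (allF⁻ _ h w))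
                          (λ h → allF⁺ _ (λ w → from (clear⇔ S u v w) (h w)))

  forces⇔ : ∀ S u v →
            forces S u v ≡ true ⇔ (S u ≡ true × adj G u v ≡ true × allF (clear S u v) ≡ true)
  forces⇔ S u v = mk⇔
    (λ h → let rest = ∧-conicalʳ (S u) _ h in
           ∧-conicalˡ _ _ h , ∧-conicalˡ (adj G u v) _ rest , ∧-conicalʳ (adj G u v) _ rest)
    (λ (Su , auv , all) → trans (cong₂ (λ b c → b ∧ c ∧ allF (clear S u v)) Su auv) all)

  blockers≡0⇔ : ∀ S u v → blockers S u v ≡ 0 ⇔ allF (clear S u v) ≡ true
  blockers≡0⇔ S u v =
    mk⇔ (λ b≡0 → allF⁺ _ λ w → not-injective (to (card≡0⇔ (not ∘ clear S u v)) b≡0 w))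
        (λ h → from (card≡0⇔ (not ∘ clear S u v)) λ w → cong not (allF⁻ _ h w))

  step-⊇ : ∀ S → S ⊆ step G S
  step-⊇ S v Sv = cong (λ b → b ∨ anyF (λ u → forces S u v)) Sv

  newlyForced⊆step : ∀ S → newlyForced S ⊆ step G S
  newlyForced⊆step S v h = trans (cong (S v ∨_) (∧-conicalʳ _ _ h)) (∨-zeroʳ (S v))

  newlyForced⇒ : ∀ S v → newlyForced S v ≡ true → S v ≡ false × ∃ λ u → forces S u v ≡ true
  newlyForced⇒ S v h = not-injective (∧-conicalˡ _ _ h) , anyF⁻ _ (∧-conicalʳ _ _ h)

  step-split : ∀ S v → b2ℕ (step G S v) ≡ b2ℕ (S v) + b2ℕ (newlyForced S v)
  step-split S v = b2ℕ-∨ (S v) _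

  forces-cong : ∀ {S S′} → S ≗ S′ → ∀ u v → forces S u v ≡ forces S′ u v
  forces-cong eq u v = cong₂ _∧_ (eq u) (cong (adj G u v ∧_)
    (allF-cong λ w → cong (λ b → not (adj G u w) ∨ (w == v) ∨ b) (eq w)))

  step-cong : ∀ {S S′} → S ≗ S′ → step G S ≗ step G S′
  step-cong eq v = cong₂ _∨_ (eq v) (anyF-cong λ u → forces-cong eq u v)

  newlyForced-cong : ∀ {S S′} → S ≗ S′ → newlyForced S ≗ newlyForced S′
  newlyForced-cong eq v = cong₂ _∧_ (cong not (eq v)) (anyF-cong λ u → forces-cong eq u v)

  newCount≡0⇒stalled : ∀ S → newCount S ≡ 0 → step G S ≗ S
  newCount≡0⇒stalled S c≡0 v = b2ℕ-injective (begin
    b2ℕ (step G S v)                    ≡⟨ step-split S v ⟩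
    b2ℕ (S v) + b2ℕ (newlyForced S v)   ≡⟨ cong (λ b → b2ℕ (S v) + b2ℕ b) (to (card≡0⇔ _) c≡0 v) ⟩
    b2ℕ (S v) + 0                       ≡⟨ ℕₚ.+-identityʳ _ ⟩
    b2ℕ (S v)                           ∎)
    where open ≡-Reasoning

  filled⇒newCount≡0 : ∀ S → AllFilled S → newCount S ≡ 0
  filled⇒newCount≡0 S filled =
    from (card≡0⇔ _) λ v → cong (λ b → not b ∧ anyF (λ u → forces S u v)) (filled v)

  fill-mono : ∀ D {j k} → j ≤ k → fill G D j ⊆ fill G D k
  fill-mono D j≤k = mono′ (ℕₚ.≤⇒≤′ j≤k)
    where
    mono′ : ∀ {j k} → j ≤′ k → fill G D j ⊆ fill G D k
    mono′ ≤′-refl        v h = h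
    mono′ (≤′-step {k} j≤′k) v h = step-⊇ (fill G D k) v (mono′ j≤′k v h)

  fill-stalled : ∀ D {j k} → step G (fill G D j) ≗ fill G D j → j ≤ k → fill G D k ≗ fill G D j
  fill-stalled D {j} stalled j≤k = stays (ℕₚ.≤⇒≤′ j≤k)
    where
    stays : ∀ {k} → j ≤′ k → fill G D k ≗ fill G D j
    stays ≤′-refl        v = refl
    stays (≤′-step j≤′k) v = trans (step-cong (stays j≤′k) v) (stalled v)

  fill-telescope : ∀ D v m → b2ℕ (D v) + sumℕ {m} (λ t → b2ℕ (newlyForced (fill G D (toℕ t)) v))
                             ≡ b2ℕ (fill G D m v)
  fill-telescope D v = telescope (λ j → b2ℕ (fill G D j v)) (λ j → b2ℕ (newlyForced (fill G D j) v))
                                 (λ j → step-split (fill G D j) v)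

  stalled⇒filled : ∀ {D} → IsZeroForcingSet G D → ∀ j →
                   step G (fill G D j) ≗ fill G D j → AllFilled (fill G D j)
  stalled⇒filled {D} (k , filled) j stalled v with ℕₚ.≤-total j k
  ... | inj₁ j≤k = trans (sym (fill-stalled D stalled j≤k v)) (filled v)
  ... | inj₂ k≤j = fill-mono D k≤j v (filled v)

  newCount≡0⇔filled : ∀ {D} → IsZeroForcingSet G D → ∀ j →
                      newCount (fill G D j) ≡ 0 ⇔ AllFilled (fill G D j)
  newCount≡0⇔filled zf j = mk⇔ (λ c≡0 → stalled⇒filled zf j (newCount≡0⇒stalled _ c≡0))
                               (filled⇒newCount≡0 _)

  unfilled⇒newlyForced : ∀ {D} → IsZeroForcingSet G D → ∀ j → ¬ AllFilled (fill G D j) →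
                         ∃ λ v → newlyForced (fill G D j) v ≡ true
  unfilled⇒newlyForced zf j ¬filled =
    card-witness _ (λ c≡0 → ¬filled (to (newCount≡0⇔filled zf j) c≡0))

  card-fill> : ∀ {D} → IsZeroForcingSet G D → ∀ j → ¬ AllFilled (fill G D j) → j < card (fill G D j)
  card-fill> {D} zf zero ¬filled =
    let v , new = unfilled⇒newlyForced zf zero ¬filled
        u , u→v = proj₂ (newlyForced⇒ D v new)
    in card-pos D (∧-conicalˡ _ _ u→v)
  card-fill> {D} zf (suc j) ¬filled =
    let v , new = unfilled⇒newlyForced zf j ¬filled-j
    in ℕₚ.≤-trans (s≤s (card-fill> zf j ¬filled-j))
                  (card-< {v = v} (step-⊇ (fill G D j)) (proj₁ (newlyForced⇒ (fill G D j) v new))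
                                  (newlyForced⊆step (fill G D j) v new))
    where
    ¬filled-j : ¬ AllFilled (fill G D j)
    ¬filled-j filled = ¬filled λ v → step-⊇ (fill G D j) v (filled v)

  filled-after : ∀ {D} → IsZeroForcingSet G D → ∀ j → n ≤ suc j → AllFilled (fill G D j)
  filled-after {D} zf j n≤1+j with Finₚ.all? (λ v → fill G D j v Bool.≟ true)
  ... | yes filled = filled
  ... | no ¬filled = card≥n⇒AllFilled _ (ℕₚ.≤-trans n≤1+j (card-fill> zf j ¬filled))

  arc-enabled-by-forcing : ∀ S u v → adj G u v ≡ true →
                           b2ℕ (S u) ≤ b2ℕ (S v) + b2ℕ (newlyForced S v) + blockers S u v
  arc-enabled-by-forcing S u v auv with S u in Su | S v in Sv
  ... | false | _     = z≤n
  ... | true  | true  = s≤s z≤n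
  ... | true  | false with blockers S u v in B
  ...   | suc k = ℕₚ.≤-trans (s≤s z≤n) (ℕₚ.m≤n+m (suc k) _)
  ...   | zero  = subst (λ b → 1 ≤ b2ℕ b + 0) (sym (anyF⁺ _ u u→v)) (s≤s z≤n)
    where
    u→v : forces S u v ≡ true
    u→v = from (forces⇔ S u v) (Su , auv , to (blockers≡0⇔ S u v) B)

  filledOthers : VSet n → Fin n → Fin n → ℕ
  filledOthers S u v = sumℕ (λ w → if adj G u w ∧ not (w == v) then b2ℕ (S w) else 0)

  deg≡ : ∀ S u v → adj G u v ≡ true → deg G u ≡ suc (filledOthers S u v + blockers S u v)
  deg≡ S u v auv = begin
    deg G u                                  ≡⟨ sumℕ-cong split ⟩
    sumℕ (λ w → f w + g w + h w)             ≡⟨ sumℕ-distrib-+ (λ w → f w + g w) h ⟩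
    sumℕ (λ w → f w + g w) + sumℕ h          ≡⟨ cong₂ _+_ (sumℕ-distrib-+ f g) (sumℕ-indicator v) ⟩
    sumℕ f + sumℕ g + 1                      ≡⟨ ℕₚ.+-comm _ 1 ⟩
    suc (sumℕ f + sumℕ g)                    ∎
    where
    open ≡-Reasoning
    f g h : Fin n → ℕ
    f w = if adj G u w ∧ not (w == v) then b2ℕ (S w) else 0
    g w = b2ℕ (not (clear S u v w))
    h w = b2ℕ (w == v)
    split : ∀ w → b2ℕ (adj G u w) ≡ f w + g w + h w
    split w = neighbour-split (adj G u w) (w == v) (S w)
                (λ w==v → subst (λ w → adj G u w ≡ true) (sym (==⇒≡ w==v)) auv)

  arc-constraint⇔ : ∀ S u v {i : ℤ} {I : ℕ} → i ≡ + I → adj G u v ≡ true →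
    (b2ℤ (S u) ℤ.- b2ℤ (S v) ℤ.+ sumℤ (λ w → if adj G u w ∧ not (w == v) then b2ℤ (S w) else + 0)
      ℤ.≤ i ℤ.+ + deg G u ℤ.- + 1)
    ⇔ b2ℕ (S u) ≤ b2ℕ (S v) + I + blockers S u v
  arc-constraint⇔ S u v {I = I} refl auv
    rewrite sumℤ-if (λ w → adj G u w ∧ not (w == v)) (b2ℕ ∘ S) | deg≡ S u v auv =
    [a-b+e]≤[i+suc[e+k]-1]⇔ (b2ℕ (S u)) (b2ℕ (S v)) (filledOthers S u v) I (blockers S u v)

falsesBefore : (ℕ → Bool) → ℕ → ℕ
falsesBefore g m = sumℕ {m} (λ t → b2ℕ (not (g (toℕ t))))

falsesBefore-least : ∀ g → (∀ j → g j ≡ true → g (suc j) ≡ true) → ∀ m → g m ≡ true →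
                     g (falsesBefore g m) ≡ true × (∀ j → g j ≡ true → falsesBefore g m ≤ j)
falsesBefore-least g mono zero    gm = gm , λ _ _ → z≤n
falsesBefore-least g mono (suc m) gm with g 0 in g0
... | true  = subst (λ c → g c ≡ true) (sym none) g0 , λ j _ → subst (_≤ j) (sym none) z≤n
  where
  always : ∀ j → g j ≡ true
  always zero    = g0
  always (suc j) = mono j (always j)
  none : falsesBefore (g ∘ suc) m ≡ 0
  none = from (sumℕ≡0⇔ {m} _) λ t → cong (b2ℕ ∘ not) (always (suc (toℕ t)))
... | false = let g[c] , least = falsesBefore-least (g ∘ suc) (mono ∘ suc) m gm
              in g[c] , λ { zero g0′ → case trans (sym g0′) g0 of λ ()
                          ; (suc j) gj → s≤s (least j gj) }

propTime : ∀ {T} → Graph (suc T) → VSet (suc T) → ℕ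
propTime {T} G D = falsesBefore (λ j → allF (fill G D j)) T

propTime-isPropTime : ∀ {T} (G : Graph (suc T)) D → AllFilled (fill G D T) → IsPropTime G D (propTime G D)
propTime-isPropTime {T} G D filled =
  let filled-pt , least = falsesBefore-least (λ j → allF (fill G D j)) mono T (allF⁺ _ filled)
  in allF⁻ _ filled-pt , λ j filled-j → least j (allF⁺ _ filled-j)
  where
  open ZeroForcing G
  mono : ∀ j → allF (fill G D j) ≡ true → allF (fill G D (suc j)) ≡ true
  mono j h = allF⁺ _ λ v → step-⊇ (fill G D j) v (allF⁻ (fill G D j) h v)

-- The integer programme

module Model {T : ℕ} (G : Graph (suc T)) (s : Sol T) where
  open ZeroForcing G

  inflow : Fin T → Fin (suc T) → ℕ
  inflow t v = sumℕ (λ u → if adj G u v then b2ℕ (y s t u v) else 0)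

  newlyFilled : Fin T → ℕ
  newlyFilled t = sumℕ (inflow t)

  prev : Fin T → VSet (suc T)
  prev t = x s (inject₁ t)

  -- Constraints (1)-(7) in the same order, read over ℕ and Bool; (5) is stated after cancelling
  -- the filled neighbours of u from both sides, and (6)-(7) form z-bounds.
  record Feasibleℕ : Set where
    field
      assigned-once   : ∀ v → b2ℕ (x s zero v) + sumℕ (λ t → inflow t v) ≡ 1
      arc-from-filled : ∀ t u v → adj G u v ≡ true → y s t u v ≡ true → prev t u ≡ true
      arc-from-forcer : ∀ t u v w → adj G u v ≡ true → adj G u w ≡ true → (w == v) ≡ false →
                        y s t u v ≡ true → prev t w ≡ true
      fill-update     : ∀ t v → b2ℕ (x s (suc t) v) ≡ b2ℕ (prev t v) + inflow t v
      arc-enabled     : ∀ t u v → adj G u v ≡ true →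
                        b2ℕ (prev t u) ≤ b2ℕ (prev t v) + inflow t v + blockers (prev t) u v
      z-bounds        : ∀ t → b2ℕ (z s t) ≤ newlyFilled t × newlyFilled t ≤ b2ℕ (z s t) * suc T

  inY≡inflow : ∀ t v → sumℤ (λ u → if adj G u v then b2ℤ (y s t u v) else + 0) ≡ + inflow t v
  inY≡inflow t v = sumℤ-if (λ u → adj G u v) (λ u → b2ℕ (y s t u v))

  total-inY≡ : ∀ v → sumℤ (λ t → sumℤ (λ u → if adj G u v then b2ℤ (y s t u v) else + 0))
                     ≡ + sumℕ (λ t → inflow t v)
  total-inY≡ v = trans (sumℤ-cong λ t → inY≡inflow t v) (sumℤ-+ (λ t → inflow t v))

  diff≡newlyFilled : (∀ t v → b2ℕ (x s (suc t) v) ≡ b2ℕ (prev t v) + inflow t v) →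
                     ∀ t → sumℤ (λ v → b2ℤ (x s (suc t) v) ℤ.- b2ℤ (prev t v)) ≡ + newlyFilled t
  diff≡newlyFilled update t =
    sumℤ-differences (λ v → b2ℕ (x s (suc t) v)) (λ v → b2ℕ (prev t v)) (inflow t) (update t)

  feasible⇒ : Feasible G s → Feasibleℕ
  feasible⇒ (c1 , c2 , c3 , c4 , c5 , c6 , c7) = record
    { assigned-once   = λ v → ℤₚ.+-injective
                          (trans (cong (λ i → b2ℤ (x s zero v) ℤ.+ i) (sym (total-inY≡ v))) (c1 v))
    ; arc-from-filled = λ t u v auv → to b2ℕ-≤⇔ (ℤₚ.drop‿+≤+ (c2 t u v auv))
    ; arc-from-forcer = λ t u v w auv auw w≠v → to b2ℕ-≤⇔ (ℤₚ.drop‿+≤+ (c3 t u v w auv auw w≠v))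
    ; fill-update     = update
    ; arc-enabled     = λ t u v auv → to (arc-constraint⇔ (prev t) u v (inY≡inflow t v) auv) (c5 t u v auv)
    ; z-bounds        = λ t →
        to ([+m]-[+n]≤0⇔ (b2ℕ (z s t)) (newlyFilled t))
           (subst (λ d → b2ℤ (z s t) ℤ.- d ℤ.≤ + 0) (diff≡newlyFilled update t) (c7 t)) ,
        to (fraction-bound⇔ (newlyFilled t) (b2ℕ (z s t)) T (diff≡newlyFilled update t)) (c6 t)
    }
    where
    update : ∀ t v → b2ℕ (x s (suc t) v) ≡ b2ℕ (prev t v) + inflow t v
    update t v = ℤₚ.+-injective (trans (c4 t v) (cong (λ i → b2ℤ (prev t v) ℤ.+ i) (inY≡inflow t v)))

  feasible⇐ : Feasibleℕ → Feasible G s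
  feasible⇐ F =
    (λ v → trans (cong (λ i → b2ℤ (x s zero v) ℤ.+ i) (total-inY≡ v)) (cong +_ (assigned-once v))) ,
    (λ t u v auv → ℤ.+≤+ (from b2ℕ-≤⇔ (arc-from-filled t u v auv))) ,
    (λ t u v w auv auw w≠v → ℤ.+≤+ (from b2ℕ-≤⇔ (arc-from-forcer t u v w auv auw w≠v))) ,
    (λ t v → trans (cong +_ (fill-update t v))
                   (cong (λ i → b2ℤ (prev t v) ℤ.+ i) (sym (inY≡inflow t v)))) ,
    (λ t u v auv → from (arc-constraint⇔ (prev t) u v (inY≡inflow t v) auv) (arc-enabled t u v auv)) ,
    (λ t → from (fraction-bound⇔ (newlyFilled t) (b2ℕ (z s t)) T (diff≡newlyFilled fill-update t))
                (proj₂ (z-bounds t))) ,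
    (λ t → subst (λ d → b2ℤ (z s t) ℤ.- d ℤ.≤ + 0) (sym (diff≡newlyFilled fill-update t))
                 (from ([+m]-[+n]≤0⇔ (b2ℕ (z s t)) (newlyFilled t)) (proj₁ (z-bounds t))))
    where open Feasibleℕ F

  InflowFollowsForcing : Set
  InflowFollowsForcing = ∀ t v → inflow t v ≡ b2ℕ (newlyForced (fill G (initialSet s) (toℕ t)) v)

  module _ (follows : InflowFollowsForcing) where

    assigned-once⇔ : ∀ v → (b2ℕ (x s zero v) + sumℕ (λ t → inflow t v) ≡ 1)
                           ⇔ fill G (initialSet s) T v ≡ true
    assigned-once⇔ v = mk⇔ (λ h → b2ℕ-injective (trans (sym total) h)) (λ h → trans total (cong b2ℕ h))
      where
      total : b2ℕ (x s zero v) + sumℕ (λ t → inflow t v) ≡ b2ℕ (fill G (initialSet s) T v)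
      total = trans (cong (_+_ (b2ℕ (x s zero v))) (sumℕ-cong λ t → follows t v))
                    (fill-telescope (initialSet s) v T)

    z-bounds⇔ : IsZeroForcingSet G (initialSet s) → ∀ t →
                (b2ℕ (z s t) ≤ newlyFilled t × newlyFilled t ≤ b2ℕ (z s t) * suc T)
                ⇔ z s t ≡ not (allF (fill G (initialSet s) (toℕ t)))
    z-bounds⇔ zf t rewrite sumℕ-cong (follows t) =
      bit-bounds⇔ (card-≤ (newlyForced S)) (allF⇔ S ⇔-∘ newCount≡0⇔filled zf (toℕ t))
      where
      S : VSet (suc T)
      S = fill G (initialSet s) (toℕ t)

module Soundness {T : ℕ} (G : Graph (suc T)) (s : Sol T) (F : Model.Feasibleℕ G s) where
  open ZeroForcing G
  open Model G s
  open Feasibleℕ F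

  C : VSet (suc T)
  C = initialSet s

  inflow≢0⇒unfilled : ∀ t v → inflow t v ≢ 0 → prev t v ≡ false
  inflow≢0⇒unfilled t v I≢0 with prev t v in Sv
  ... | false = refl
  ... | true  = ⊥-elim (I≢0 (ℕₚ.n≤0⇒n≡0 (ℕₚ.≤-pred (subst (_≤ 1) 1+I≡x (b2ℕ≤1 _)))))
    where
    1+I≡x : b2ℕ (x s (suc t) v) ≡ 1 + inflow t v
    1+I≡x = trans (fill-update t v) (cong (λ b → b2ℕ b + inflow t v) Sv)

  inflow≢0⇒forced : ∀ t v → inflow t v ≢ 0 → ∃ λ u → forces (prev t) u v ≡ true
  inflow≢0⇒forced t v I≢0 with sumℕ-witness (λ u → if adj G u v then b2ℕ (y s t u v) else 0) I≢0
  ... | u , term≢0 with adj G u v in auv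
  ...   | false = ⊥-elim (term≢0 refl)
  ...   | true  = let yuv = b2ℕ-≢0 term≢0 in
    u , from (forces⇔ (prev t) u v)
             (arc-from-filled t u v auv yuv , auv ,
              from (allF-clear⇔ (prev t) u v) λ w auw w≠v → arc-from-forcer t u v w auv auw w≠v yuv)

  forced⇒inflow≢0 : ∀ t u v → prev t v ≡ false → forces (prev t) u v ≡ true → inflow t v ≢ 0
  forced⇒inflow≢0 t u v Sv u→v I≡0 =
    let Su , auv , all = to (forces⇔ (prev t) u v) u→v in
    case (begin
      1                                                    ≡⟨ cong b2ℕ (sym Su) ⟩
      b2ℕ (prev t u)                                       ≤⟨ arc-enabled t u v auv ⟩
      b2ℕ (prev t v) + inflow t v + blockers (prev t) u v  ≡⟨ cong₂ (λ b i → b2ℕ b + i + B) Sv I≡0 ⟩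
      blockers (prev t) u v                                ≡⟨ from (blockers≡0⇔ (prev t) u v) all ⟩
      0                                                    ∎) of λ ()
    where
    open ℕₚ.≤-Reasoning
    B : ℕ
    B = blockers (prev t) u v

  inflow≡newlyForced : ∀ t v → inflow t v ≡ b2ℕ (newlyForced (prev t) v)
  inflow≡newlyForced t v = ≤1⇒≡b2ℕ inflow≤1 (mk⇔ ⇒ ⇐)
    where
    inflow≤1 : inflow t v ≤ 1
    inflow≤1 = ℕₚ.m+n≤o⇒n≤o (b2ℕ (prev t v)) (subst (_≤ 1) (fill-update t v) (b2ℕ≤1 _))
    ⇒ : inflow t v ≢ 0 → newlyForced (prev t) v ≡ true
    ⇒ I≢0 = let u , u→v = inflow≢0⇒forced t v I≢0 in
            cong₂ (λ a b → not a ∧ b) (inflow≢0⇒unfilled t v I≢0)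
                                        (anyF⁺ (λ u → forces (prev t) u v) u u→v)
    ⇐ : newlyForced (prev t) v ≡ true → inflow t v ≢ 0
    ⇐ new = let Sv , u , u→v = newlyForced⇒ (prev t) v new in forced⇒inflow≢0 t u v Sv u→v

  x-step : ∀ t → x s (suc t) ≗ step G (prev t)
  x-step t v = b2ℕ-injective (begin
    b2ℕ (x s (suc t) v)                            ≡⟨ fill-update t v ⟩
    b2ℕ (prev t v) + inflow t v                    ≡⟨ cong (_+_ _) (inflow≡newlyForced t v) ⟩
    b2ℕ (prev t v) + b2ℕ (newlyForced (prev t) v)  ≡⟨ sym (step-split (prev t) v) ⟩
    b2ℕ (step G (prev t) v)                        ∎)
    where open ≡-Reasoning

  x≗fill : ∀ k (t : Fin (suc T)) → toℕ t ≡ k → x s t ≗ fill G C k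
  x≗fill zero    zero    _       v = refl
  x≗fill zero    (suc t) ()
  x≗fill (suc k) zero    ()
  x≗fill (suc k) (suc t) t+1≡k+1 v = trans (x-step t v) (step-cong (x≗fill k (inject₁ t) t≡k) v)
    where
    t≡k : toℕ (inject₁ t) ≡ k
    t≡k = trans (Finₚ.toℕ-inject₁ t) (ℕₚ.suc-injective t+1≡k+1)

  follows : InflowFollowsForcing
  follows t v = trans (inflow≡newlyForced t v)
    (cong b2ℕ (newlyForced-cong (x≗fill (toℕ t) (inject₁ t) (Finₚ.toℕ-inject₁ t)) v))

  C-zf : IsZeroForcingSet G C
  C-zf = T , λ v → to (assigned-once⇔ follows v) (assigned-once v)

  zSum≡propTime : zSum s ≡ propTime G C
  zSum≡propTime = sumℕ-cong λ t → cong b2ℕ (to (z-bounds⇔ follows C-zf t) (z-bounds t))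

module Completeness {T : ℕ} (G : Graph (suc T)) (D : VSet (suc T)) (zf : IsZeroForcingSet G D) where
  open ZeroForcing G

  before : Fin T → VSet (suc T)
  before t = fill G D (toℕ t)

  -- Each vertex newly forced at step t receives the arc from the first vertex forcing it.
  solution : Sol T
  solution = record
    { x = λ t → fill G D (toℕ t)
    ; y = λ t u v → not (before t v) ∧ first (λ u → forces (before t) u v) u
    ; z = λ t → not (allF (before t))
    }

  open Model G solution

  prev≗before : ∀ t → prev t ≗ before t
  prev≗before t v = cong (λ j → fill G D j v) (Finₚ.toℕ-inject₁ t)

  y⇒forces : ∀ t u v → y solution t u v ≡ true → forces (before t) u v ≡ true
  y⇒forces t u v h = first⇒ (λ u → forces (before t) u v) u (∧-conicalʳ _ _ h)

  card-y≡ : ∀ t v → card (λ u → y solution t u v) ≡ b2ℕ (newlyForced (before t) v)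
  card-y≡ t v with before t v
  ... | true  = from (card≡0⇔ {suc T} (λ _ → false)) (λ _ → refl)
  ... | false = card-first (λ u → forces (before t) u v)

  follows : InflowFollowsForcing
  follows t v = trans (sumℕ-if-redundant (λ u → adj G u v) (λ u → y solution t u v) y⇒adj) (card-y≡ t v)
    where
    y⇒adj : ∀ u → y solution t u v ≡ true → adj G u v ≡ true
    y⇒adj u h = proj₁ (proj₂ (to (forces⇔ (before t) u v) (y⇒forces t u v h)))

  feasibleℕ : Feasibleℕ
  feasibleℕ = record
    { assigned-once   = λ v → from (assigned-once⇔ follows v) (filled-after zf T ℕₚ.≤-refl v)
    ; arc-from-filled = λ t u v _ yuv →
        trans (prev≗before t u) (proj₁ (to (forces⇔ (before t) u v) (y⇒forces t u v yuv)))
    ; arc-from-forcer = λ t u v w _ auw w≠v yuv → trans (prev≗before t w)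
        (to (allF-clear⇔ (before t) u v) (proj₂ (proj₂ (to (forces⇔ (before t) u v) (y⇒forces t u v yuv))))
            w auw w≠v)
    ; fill-update     = λ t v → trans (step-split (before t) v)
                                      (cong₂ _+_ (cong b2ℕ (sym (prev≗before t v))) (sym (follows t v)))
    ; arc-enabled     = enabled
    ; z-bounds        = λ t → from (z-bounds⇔ follows zf t) refl
    }
    where
    enabled : ∀ t u v → adj G u v ≡ true →
              b2ℕ (prev t u) ≤ b2ℕ (prev t v) + inflow t v + blockers (prev t) u v
    enabled t u v auv rewrite Finₚ.toℕ-inject₁ t | follows t v = arc-enabled-by-forcing (before t) u v auv

  feasible : Feasible G solution
  feasible = feasible⇐ feasibleℕ

objective-≤⇒ : ∀ {T} (s s′ : Sol T) → objective s ℚ.≤ objective s′ →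
               card (initialSet s) ≤ card (initialSet s′) ×
               (card (initialSet s) ≡ card (initialSet s′) → zSum s ≤ zSum s′)
objective-≤⇒ {zero}  s s′ h =
  ℤₚ.drop‿+≤+ (subst₂ ℤ._≤_ (ℤₚ.*-identityʳ _) (ℤₚ.*-identityʳ _)
    (to (/-≤-/⇔ (+ card (initialSet s)) 0 (+ card (initialSet s′)) 0) h)) , λ _ → z≤n
objective-≤⇒ {suc k} s s′ h =
  lex-≤ (ℕₚ.≤-<-trans (card-≤ (z s′)) (ℕₚ.m<m+n (suc k) (s≤s z≤n)))
        (mixed-≤⇒ (card (initialSet s)) (zSum s) (card (initialSet s′)) (zSum s′) (pred (2 * suc k)) h)

corollary4p5 : (T : ℕ) (G : Graph (suc T)) (s : Sol T) → IsOptimal G s →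
    IsMinZeroForcingSet G (initialSet s) ×
    IsGraphPropTime G (zSum s) × IsPropTime G (initialSet s) (zSum s)
corollary4p5 T G s (feasible , optimal) = minimal , ((C , minimal , C-time) , least) , C-time
  where
  open Soundness G s (Model.feasible⇒ G s feasible)
  compare : ∀ D → IsZeroForcingSet G D → card C ≤ card D × (card C ≡ card D → zSum s ≤ propTime G D)
  compare D zf = objective-≤⇒ s (Completeness.solution G D zf) (optimal _ (Completeness.feasible G D zf))
  minimal : IsMinZeroForcingSet G C
  minimal = C-zf , λ D zf → proj₁ (compare D zf)
  C-time : IsPropTime G C (zSum s)
  C-time = subst (IsPropTime G C) (sym zSum≡propTime) (propTime-isPropTime G C (proj₂ C-zf))
  least : ∀ D j → IsMinZeroForcingSet G D → IsPropTime G D j → zSum s ≤ j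
  least D j (zf , D-min) (filled-j , _) = ℕₚ.≤-trans
    (proj₂ (compare D zf) (ℕₚ.≤-antisym (proj₁ (compare D zf)) (D-min C C-zf)))
    (proj₂ (propTime-isPropTime G D (ZeroForcing.filled-after G zf T ℕₚ.≤-refl)) j filled-j)
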